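{- Let $T$ be a finite ASBG-colourable tree and let $r$ be a vertex of $T$. Then there is a sequence of removals of leaf-twig configurations that reduces $T$ to a subgraph consisting of $r$ together with only leaves adjacent to $r$ and twigs whose bases are adjacent to $r$, in which the number of such leaves is exactly one more than the number of such twigs.
   Context: A colouring of a graph is a map from its edges to $\{\text{blue},\text{red}\}$. An ASBG is a bipartite graph with no isolated vertices and edges coloured blue and red, for which there is a linear ordering of the vertices such that for every vertex $u$ with neighbours listed in this order as $v_1,\dots,v_k$, the edges $uv_1,\dots,uv_k$ alternate in colour, starting and ending with blue; a graph is ASBG-colourable if some colouring makes it an ASBG. A leaf is a vertex of degree $1$. A twig is a vertex $b$ of degree $3$ (the base) together with two leaves adjacent to $b$. A leaf-twig configuration at a vertex $v$ consists of four vertices distinct from $v$: a leaf $\ell$ and a twig with base $b$, where $\ell$ and $b$ are both adjacent to $v$; removing it means deleting these four vertices and their four incident edges. -}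

module Defs where

open import Data.Nat using (ℕ; suc; _≤_)
open import Data.Bool using (Bool; true; false; _∧_; _∨_; not)
open import Data.Fin using (Fin; _≟_)
open import Data.List using (List; []; _∷_; length; allFin; filterᵇ; map; _∷ʳ_)
open import Data.List.Relation.Unary.Linked using (Linked)
open import Data.List.Relation.Unary.Unique.Propositional using (Unique)
open import Data.Fin.Permutation using (Permutation′; _⟨$⟩ʳ_)
open import Data.Product using (Σ; ∃; _×_; _,_)
open import Data.Sum using (_⊎_)
open import Relation.Nullary using (¬_; does)
open import Relation.Binary.PropositionalEquality using (_≡_; _≢_)
open import Relation.Binary.Construct.Closure.ReflexiveTransitive using (Star)

record Graph (n : ℕ) : Set where
  field
    adj   : Fin n → Fin n → Bool
    sym   : ∀ u v → adj u v ≡ adj v u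
    irrefl : ∀ v → adj v v ≡ false

module _ {n : ℕ} (G : Graph n) where
  open Graph G

  Adj : Fin n → Fin n → Set
  Adj u v = adj u v ≡ true

  data Walk : Fin n → Fin n → Set where
    here : ∀ {v} → Walk v v
    step : ∀ {u w v} → Adj u w → Walk w v → Walk u v

  Connected : Set
  Connected = ∀ u v → Walk u v

  -- a cycle x ∷ xs : at least 3 distinct vertices, consecutive ones adjacent,
  -- and the last adjacent to the first
  IsCycle : Fin n → List (Fin n) → Set
  IsCycle x xs = (2 ≤ length xs) × Unique (x ∷ xs) × Linked Adj ((x ∷ xs) ∷ʳ x)

  Acyclic : Set
  Acyclic = ∀ x xs → ¬ IsCycle x xs

  IsTree : Set
  IsTree = Connected × Acyclic

  Bipartite : Set
  Bipartite = Σ (Fin n → Bool) λ side → ∀ u v → Adj u v → side u ≢ side v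

  NoIsolated : Set
  NoIsolated = ∀ v → ∃ λ u → Adj v u

data Colour : Set where
  blue red : Colour

data Alternating : List Colour → Set where
  single : Alternating (blue ∷ [])
  cons   : ∀ {cs} → Alternating cs → Alternating (blue ∷ red ∷ cs)

module _ {n : ℕ} (G : Graph n) where
  open Graph G

  IsEdgeColouring : (Fin n → Fin n → Colour) → Set
  IsEdgeColouring c = ∀ u v → Adj G u v → c u v ≡ c v u

  -- neighbours of u listed in the linear order given by σ
  -- (σ maps position i to the i-th vertex of the order)
  orderedNeighbours : Permutation′ n → Fin n → List (Fin n)
  orderedNeighbours σ u = filterᵇ (adj u) (map (σ ⟨$⟩ʳ_) (allFin n))

  IsASBG : (Fin n → Fin n → Colour) → Set
  IsASBG c = Bipartite G × NoIsolated G × IsEdgeColouring c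
           × Σ (Permutation′ n) λ σ →
               ∀ u → Alternating (map (c u) (orderedNeighbours σ u))

  ASBGColourable : Set
  ASBGColourable = Σ (Fin n → Fin n → Colour) IsASBG

module _ {n : ℕ} (G : Graph n) where
  open Graph G

  VSet : Set
  VSet = Fin n → Bool

  countᵇ : (Fin n → Bool) → ℕ
  countᵇ p = length (filterᵇ p (allFin n))

  deg : VSet → Fin n → ℕ
  deg S v = countᵇ (λ u → S u ∧ adj v u)

  _∈ˢ_ : Fin n → VSet → Set
  v ∈ˢ S = S v ≡ true

  IsLeaf : VSet → Fin n → Set
  IsLeaf S v = v ∈ˢ S × deg S v ≡ 1

  IsTwig : VSet → (b l₁ l₂ : Fin n) → Set
  IsTwig S b l₁ l₂ = b ∈ˢ S × deg S b ≡ 3 × l₁ ≢ l₂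
                   × IsLeaf S l₁ × IsLeaf S l₂ × Adj G b l₁ × Adj G b l₂

  LeafTwigConfig : VSet → (v ℓ b l₁ l₂ : Fin n) → Set
  LeafTwigConfig S v ℓ b l₁ l₂ =
      v ∈ˢ S × IsLeaf S ℓ × IsTwig S b l₁ l₂
    × Adj G v ℓ × Adj G v b
    × ℓ ≢ v × b ≢ v × l₁ ≢ v × l₂ ≢ v
    × ℓ ≢ b × ℓ ≢ l₁ × ℓ ≢ l₂

  remove4 : VSet → (ℓ b l₁ l₂ : Fin n) → VSet
  remove4 S ℓ b l₁ l₂ u =
    S u ∧ not (does (u ≟ ℓ) ∨ does (u ≟ b) ∨ does (u ≟ l₁) ∨ does (u ≟ l₂))

  data RemovalStep : VSet → VSet → Set where
    removal : ∀ {S} v ℓ b l₁ l₂ → LeafTwigConfig S v ℓ b l₁ l₂ →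
              RemovalStep S (remove4 S ℓ b l₁ l₂)

  Removals : VSet → VSet → Set
  Removals = Star RemovalStep

  TwigBaseAt : VSet → Fin n → Fin n → Set
  TwigBaseAt S r b = ∃ λ l₁ → ∃ λ l₂ → IsTwig S b l₁ l₂ × l₁ ≢ r × l₂ ≢ r

  StarOfLeavesAndTwigs : VSet → Fin n → Set
  StarOfLeavesAndTwigs S r =
      r ∈ˢ S
    × (∀ u → u ∈ˢ S → Adj G r u → IsLeaf S u ⊎ TwigBaseAt S r u)
    × (∀ u → u ∈ˢ S → u ≢ r →
         Adj G r u ⊎ (∃ λ b → b ∈ˢ S × Adj G r b × TwigBaseAt S r b × Adj G b u))

  -- number of leaves adjacent to r / of twigs with base adjacent to r
  -- (under StarOfLeavesAndTwigs, the neighbours of r are exactly the leaves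
  --  (degree 1) and the twig bases (degree 3))
  numLeavesAt : VSet → Fin n → ℕ
  numLeavesAt S r = countᵇ (λ u → S u ∧ adj r u ∧ does (deg S u Data.Nat.≟ 1))

  numTwigsAt : VSet → Fin n → ℕ
  numTwigsAt S r = countᵇ (λ u → S u ∧ adj r u ∧ does (deg S u Data.Nat.≟ 3))

  allVertices : VSet
  allVertices _ = true

module Submission where

-- Root T at r and call a vertex set S balanced if it contains r, is closed under
-- taking parents, and every vertex of S has exactly one more blue than red
-- neighbour inside S.  The whole tree is balanced, since the colours around a
-- vertex of an ASBG alternate blue, red, ..., blue.  In a balanced S a childless
-- vertex is a leaf hanging from a blue edge, and a vertex whose children are all
-- childless is the base of a twig hanging from a red edge.  So if S has depth at
-- least 3, the parent p of a deepest vertex is a twig base with a red edge to its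
-- parent g; balance at g gives g a second blue child ℓ, which must be a leaf
-- (a twig base would hang from a red edge).  Removing ℓ and the twig at p is a
-- leaf-twig removal at g which keeps S balanced: g loses one blue and one red
-- neighbour.  Once the depth is at most 2, the neighbours of r are leaves (blue
-- edges) and twig bases (red edges), and balance at r is the required count.

open import Algebra.Properties.CommutativeSemigroup using (interchange; x∙yz≈y∙xz)
import Algebra.Properties.CommutativeMonoid.Sum as MonoidSum
open import Data.Bool using (Bool; true; false; _∧_; _∨_; not; if_then_else_)
import Data.Bool as Bool
open import Data.Bool.Properties
  using (∧-assoc; ∧-comm; ∧-identityʳ; ∧-zeroʳ; ∧-conicalˡ; ∧-conicalʳ; not-injective; ¬-not)
open import Data.Empty using (⊥-elim)
open import Data.Fin using (Fin; zero; suc; _≟_)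
open import Data.Fin.Permutation using (Permutation′; _⟨$⟩ʳ_)
open import Data.Fin.Properties using (any?)
open import Data.List
  using (List; []; _∷_; _++_; length; last; filterᵇ; map; allFin; tabulate; applyUpTo; applyDownFrom)
open import Data.List.Properties using (++-assoc)
open import Data.List.Relation.Unary.All using (All; []; _∷_)
import Data.List.Relation.Unary.All.Properties as All
open import Data.List.Relation.Unary.AllPairs using (AllPairs; []; _∷_)
import Data.List.Relation.Unary.AllPairs.Properties as AllPairs
open import Data.List.Relation.Unary.Linked using (Linked; []; [-]; _∷_)
import Data.List.Relation.Unary.Linked.Properties as Linked
open import Data.Maybe using (just)
import Data.Maybe.Relation.Binary.Connected as Maybe
open import Data.Nat using (ℕ; zero; suc; pred; _+_; _∸_; _≤_; _<_; z≤n; s≤s; z<s; _≤?_)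
import Data.Nat as ℕ
open import Data.Nat.GeneralisedArithmetic using (fold)
open import Data.Nat.Induction using (<-wellFounded)
open import Data.Nat.Properties
  using ( suc-injective; +-suc; +-identityʳ; +-cancelˡ-≡; +-cancelʳ-≡; m+[n∸m]≡n
        ; ≤-refl; ≤-reflexive; ≤-trans; ≤-antisym; ≤-pred; ≰⇒>; <⇒≤; <⇒≢; <-irrefl; <-trans; <-≤-trans; <-cmp
        ; n≤1+n; n<1+n; m≤m+n; m≤n+m; m<n+m; n≤0⇒n≡0; n≮0; 1+n≰n; 1+n≢n; m≢1+n+m
        ; +-commutativeSemigroup; +-0-commutativeMonoid; module ≤-Reasoning)
open import Data.Product using (Σ; ∃; ∃₂; _×_; _,_; proj₁; proj₂; map₁; map₂)
open import Data.Sum using (_⊎_; inj₁; inj₂; [_,_]′)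
import Data.Sum as Sum
open import Function using (_∘_; _∘₂_; case_of_)
open import Induction.WellFounded using (Acc; acc)
open import Relation.Binary.Construct.Closure.ReflexiveTransitive using (ε; _◅_)
open import Relation.Binary.Definitions using (tri<; tri≈; tri>)
open import Relation.Binary.PropositionalEquality
open import Relation.Nullary using (¬_; does; yes; no)
open import Relation.Nullary.Decidable using (dec-true; dec-false)

open import Defs

∧-false : ∀ a {b} → (a ≡ true → b ≡ false) → (a ∧ b) ≡ false
∧-false true  a⇒¬b = a⇒¬b refl
∧-false false _    = refl

∧-absorbs : ∀ a {b} → (a ≡ true → b ≡ true) → (a ∧ b) ≡ a
∧-absorbs true  a⇒b = a⇒b refl
∧-absorbs false _   = refl

infix 4 _==_
_==_ : ∀ {n} → Fin n → Fin n → Bool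
x == y = does (x ≟ y)

==-refl : ∀ {n} (x : Fin n) → (x == x) ≡ true
==-refl x = dec-true (x ≟ x) refl

==⇒≡ : ∀ {n} {x y : Fin n} → (x == y) ≡ true → x ≡ y
==⇒≡ {x = x} {y} e with x ≟ y
... | yes x≡y = x≡y

≢⇒==-false : ∀ {n} {x y : Fin n} → x ≢ y → (x == y) ≡ false
≢⇒==-false {x = x} {y} = dec-false (x ≟ y)

fromBool : Bool → ℕ
fromBool b = if b then 1 else 0

count : ∀ {n} → (Fin n → Bool) → ℕ
count {zero}  f = 0
count {suc n} f = fromBool (f zero) + count (λ x → f (suc x))

count-cong : ∀ {n} {f g : Fin n → Bool} → (∀ x → f x ≡ g x) → count f ≡ count g
count-cong {zero}  f≗g = refl
count-cong {suc n} f≗g = cong₂ _+_ (cong fromBool (f≗g zero)) (count-cong (λ x → f≗g (suc x)))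

count-split : ∀ {n} (f q : Fin n → Bool) →
              count f ≡ count (λ x → f x ∧ q x) + count (λ x → f x ∧ not (q x))
count-split {zero}  f q = refl
count-split {suc n} f q = begin
  fromBool (f zero) + count (λ x → f (suc x))
    ≡⟨ cong₂ _+_ (split (f zero) (q zero)) (count-split (λ x → f (suc x)) (λ x → q (suc x))) ⟩
  (head-q + head-¬q) + (tail-q + tail-¬q)
    ≡⟨ interchange +-commutativeSemigroup head-q head-¬q tail-q tail-¬q ⟩
  (head-q + tail-q) + (head-¬q + tail-¬q) ∎
  where
  open ≡-Reasoning
  head-q head-¬q tail-q tail-¬q : ℕ
  head-q  = fromBool (f zero ∧ q zero)
  head-¬q = fromBool (f zero ∧ not (q zero))
  tail-q  = count (λ x → f (suc x) ∧ q (suc x))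
  tail-¬q = count (λ x → f (suc x) ∧ not (q (suc x)))
  split : ∀ a b → fromBool a ≡ fromBool (a ∧ b) + fromBool (a ∧ not b)
  split true  true  = refl
  split true  false = refl
  split false b     = refl

count-pick : ∀ {n} (f : Fin n → Bool) (a : Fin n) →
             count f ≡ fromBool (f a) + count (λ x → f x ∧ not (x == a))
count-pick {suc n} f zero = cong (fromBool (f zero) +_) (cong₂ _+_
  (cong fromBool (sym (∧-zeroʳ (f zero)))) (count-cong (λ x → sym (∧-identityʳ (f (suc x))))))
count-pick {suc n} f (suc a) = begin
  fromBool (f zero) + count (λ x → f (suc x))
    ≡⟨ cong (fromBool (f zero) +_) (count-pick (λ x → f (suc x)) a) ⟩
  fromBool (f zero) + (fromBool (f (suc a)) + rest)
    ≡⟨ x∙yz≈y∙xz +-commutativeSemigroup (fromBool (f zero)) (fromBool (f (suc a))) rest ⟩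
  fromBool (f (suc a)) + (fromBool (f zero) + rest)
    ≡⟨ cong (λ b → fromBool (f (suc a)) + (fromBool b + rest)) (sym (∧-identityʳ (f zero))) ⟩
  fromBool (f (suc a)) + (fromBool (f zero ∧ true) + rest) ∎
  where
  open ≡-Reasoning
  rest = count (λ x → f (suc x) ∧ not (x == a))

count-pick-true : ∀ {n} (f : Fin n → Bool) (a : Fin n) → f a ≡ true →
                  count f ≡ suc (count (λ x → f x ∧ not (x == a)))
count-pick-true f a fa =
  trans (count-pick f a) (cong (λ b → fromBool b + count (λ x → f x ∧ not (x == a))) fa)

count-all-false : ∀ {n} {f : Fin n → Bool} → (∀ x → f x ≡ false) → count f ≡ 0
count-all-false {zero}  f≡false = refl
count-all-false {suc n} f≡false rewrite f≡false zero = count-all-false (λ x → f≡false (suc x))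

count≡0⇒false : ∀ {n} (f : Fin n → Bool) → count f ≡ 0 → ∀ x → f x ≡ false
count≡0⇒false f c≡0 x with f x | count-pick f x
... | true  | c≡1+ = case trans (sym c≡0) c≡1+ of λ ()
... | false | _    = refl

count-witness : ∀ {n} (f : Fin n → Bool) {k} → count f ≡ suc k → ∃ λ x → f x ≡ true
count-witness f {k} c≡1+k with any? (λ x → f x Bool.≟ true)
... | yes witness = witness
... | no  none    = case trans (sym c≡1+k) (count-all-false (λ x → ¬-not (none ∘ (x ,_)))) of λ ()

count≡2 : ∀ {n} (f : Fin n → Bool) → count f ≡ 2 →
          ∃₂ λ x y → x ≢ y × f x ≡ true × f y ≡ true × (∀ z → f z ≡ true → z ≡ x ⊎ z ≡ y)
count≡2 {n} f c≡2 = x , y , x≢y , fx , ∧-conicalˡ (f y) _ gy , only-x-y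
  where
  x-wit = count-witness f c≡2
  x  = proj₁ x-wit
  fx = proj₂ x-wit
  g : Fin n → Bool
  g z = f z ∧ not (z == x)
  c≡1 : count g ≡ 1
  c≡1 = suc-injective (trans (sym (count-pick-true f x fx)) c≡2)
  y-wit = count-witness g c≡1
  y  = proj₁ y-wit
  gy = proj₂ y-wit
  x≢y : x ≢ y
  x≢y x≡y = case trans (sym (∧-conicalʳ (f y) _ gy)) (cong not (trans (cong (_== x) (sym x≡y)) (==-refl x)))
            of λ ()
  rest≡0 : count (λ z → g z ∧ not (z == y)) ≡ 0
  rest≡0 = suc-injective (trans (sym (count-pick-true g y gy)) c≡1)
  only-x-y : ∀ z → f z ≡ true → z ≡ x ⊎ z ≡ y
  only-x-y z fz with z ≟ x | z ≟ y
  ... | yes z≡x | _       = inj₁ z≡x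
  ... | no  _   | yes z≡y = inj₂ z≡y
  ... | no  z≢x | no  z≢y = case trans (sym (count≡0⇒false _ rest≡0 z)) remains of λ ()
    where
    remains : (g z ∧ not (z == y)) ≡ true
    remains rewrite fz | ≢⇒==-false z≢x | ≢⇒==-false z≢y = refl

count-without-disjoint : ∀ {n} (f R : Fin n → Bool) → (∀ x → f x ≡ true → R x ≡ false) →
                         count (λ x → f x ∧ not (R x)) ≡ count f
count-without-disjoint f R disjoint = sym (trans (count-split f R)
  (cong (_+ count (λ x → f x ∧ not (R x))) (count-all-false (λ x → ∧-false (f x) (disjoint x)))))

count-without-single : ∀ {n} (f R : Fin n → Bool) (a : Fin n) → f a ≡ true → R a ≡ true →
                       (∀ x → f x ≡ true → R x ≡ true → x ≡ a) →
                       count f ≡ suc (count (λ x → f x ∧ not (R x)))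
count-without-single f R a fa Ra only-a =
  trans (count-split f R) (cong (_+ count (λ x → f x ∧ not (R x))) (begin
  count (λ x → f x ∧ R x)
    ≡⟨ count-pick (λ x → f x ∧ R x) a ⟩
  fromBool (f a ∧ R a) + count (λ x → (f x ∧ R x) ∧ not (x == a))
    ≡⟨ cong₂ _+_ (cong fromBool (cong₂ _∧_ fa Ra)) (count-all-false none-but-a) ⟩
  1 ∎))
  where
  open ≡-Reasoning
  none-but-a : ∀ x → ((f x ∧ R x) ∧ not (x == a)) ≡ false
  none-but-a x with f x in fx | R x in Rx
  ... | true  | true  rewrite only-a x fx Rx | ==-refl a = refl
  ... | true  | false = refl
  ... | false | _     = refl

count-permute : ∀ {n} (f : Fin n → Bool) (σ : Permutation′ n) → count (λ x → f (σ ⟨$⟩ʳ x)) ≡ count f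
count-permute f σ = begin
  count (λ x → f (σ ⟨$⟩ʳ x))          ≡⟨ count≡sum (λ x → f (σ ⟨$⟩ʳ x)) ⟩
  sum (λ x → fromBool (f (σ ⟨$⟩ʳ x))) ≡⟨ sum-permute (λ x → fromBool (f x)) σ ⟨
  sum (λ x → fromBool (f x))          ≡⟨ count≡sum f ⟨
  count f                             ∎
  where
  open ≡-Reasoning
  open MonoidSum +-0-commutativeMonoid using (sum; sum-permute)
  count≡sum : ∀ {n} (f : Fin n → Bool) → count f ≡ sum (λ x → fromBool (f x))
  count≡sum {zero}  f = refl
  count≡sum {suc n} f = cong (fromBool (f zero) +_) (count≡sum (λ x → f (suc x)))

least-true : (f : ℕ → Bool) (m : ℕ) → f m ≡ true →
             Σ ℕ λ k → f k ≡ true × (∀ j → j < k → f j ≡ false)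
least-true f zero f0 = zero , f0 , λ _ ()
least-true f (suc m) fm with f zero in f0
... | true  = zero , f0 , λ _ ()
... | false with least-true (f ∘ suc) m fm
...   | k , fk , below = suc k , fk , λ { zero _ → f0 ; (suc j) (s≤s j<k) → below j j<k }

argmax : ∀ {n} (P : Fin n → Bool) (h : Fin n → ℕ) →
         (∀ x → P x ≡ false) ⊎ ∃ λ u → P u ≡ true × (∀ y → P y ≡ true → h y ≤ h u)
argmax {zero}  P h = inj₁ λ ()
argmax {suc n} P h with argmax (P ∘ suc) (h ∘ suc) | P zero in P0
... | inj₁ none | false = inj₁ λ { zero → P0 ; (suc x) → none x }
... | inj₁ none | true  =
  inj₂ (zero , P0 , λ { zero _ → ≤-refl ; (suc y) Py → case trans (sym Py) (none y) of λ () })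
... | inj₂ (u , Pu , max) | false =
  inj₂ (suc u , Pu , λ { zero P0′ → case trans (sym P0′) P0 of λ () ; (suc y) → max y })
... | inj₂ (u , Pu , max) | true with h zero ≤? h (suc u)
...   | yes h0≤hu = inj₂ (suc u , Pu , λ { zero _ → h0≤hu ; (suc y) → max y })
...   | no  h0≰hu =
  inj₂ (zero , P0 , λ { zero _ → ≤-refl ; (suc y) Py → ≤-trans (max y Py) (<⇒≤ (≰⇒> h0≰hu)) })

countList : ∀ {A : Set} → (A → Bool) → List A → ℕ
countList p xs = length (filterᵇ p xs)

countList-map : ∀ {A B : Set} (p : B → Bool) (h : A → B) xs →
                countList p (map h xs) ≡ countList (p ∘ h) xs
countList-map p h []       = refl
countList-map p h (x ∷ xs) with p (h x)
... | true  = cong suc (countList-map p h xs)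
... | false = countList-map p h xs

countList-filter : ∀ {A : Set} (p q : A → Bool) xs →
                   countList p (filterᵇ q xs) ≡ countList (λ x → q x ∧ p x) xs
countList-filter p q []       = refl
countList-filter p q (x ∷ xs) with q x
... | false = countList-filter p q xs
... | true with p x
...   | true  = cong suc (countList-filter p q xs)
...   | false = countList-filter p q xs

countList-tabulate : ∀ {n} {A : Set} (p : A → Bool) (h : Fin n → A) →
                     countList p (tabulate h) ≡ count (p ∘ h)
countList-tabulate {zero}  p h = refl
countList-tabulate {suc n} p h with p (h zero)
... | true  = cong suc (countList-tabulate p (h ∘ suc))
... | false = countList-tabulate p (h ∘ suc)

countList-permutedFin : ∀ {n} (p : Fin n → Bool) (σ : Permutation′ n) →
                        countList p (map (σ ⟨$⟩ʳ_) (allFin n)) ≡ count p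
countList-permutedFin {n} p σ = begin
  countList p (map (σ ⟨$⟩ʳ_) (allFin n)) ≡⟨ countList-map p (σ ⟨$⟩ʳ_) (allFin n) ⟩
  countList (p ∘ (σ ⟨$⟩ʳ_)) (allFin n)   ≡⟨ countList-tabulate (p ∘ (σ ⟨$⟩ʳ_)) (λ x → x) ⟩
  count (p ∘ (σ ⟨$⟩ʳ_))                  ≡⟨ count-permute p σ ⟩
  count p                                ∎
  where open ≡-Reasoning

last-applyUpTo : ∀ {A : Set} (f : ℕ → A) m → last (applyUpTo f (suc m)) ≡ just (f m)
last-applyUpTo f zero    = refl
last-applyUpTo f (suc m) = last-applyUpTo (f ∘ suc) m

last-applyDownFrom : ∀ {A : Set} (f : ℕ → A) m → last (applyDownFrom f (suc m)) ≡ just (f 0)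
last-applyDownFrom f zero    = refl
last-applyDownFrom f (suc m) = last-applyDownFrom f m

countᵇ≡count : ∀ {n} (G : Graph n) (p : Fin n → Bool) → countᵇ G p ≡ count p
countᵇ≡count G p = countList-tabulate p (λ x → x)

isBlue : Colour → Bool
isBlue blue = true
isBlue red  = false

alternating-balanced : ∀ {cs} → Alternating cs →
                       countList isBlue cs ≡ suc (countList (not ∘ isBlue) cs)
alternating-balanced single   = refl
alternating-balanced (cons a) = cong suc (alternating-balanced a)

module ColourBalance {n : ℕ} (G : Graph n) (c : Fin n → Fin n → Colour) where
  open Graph G using (adj)

  blueNbrs redNbrs : VSet G → Fin n → Fin n → Bool
  blueNbrs S v w = S w ∧ adj v w ∧ isBlue (c v w)
  redNbrs  S v w = S w ∧ adj v w ∧ not (isBlue (c v w))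

  Balanced : VSet G → Fin n → Set
  Balanced S v = count (blueNbrs S v) ≡ suc (count (redNbrs S v))

  alternating⇒balanced : (σ : Permutation′ n) →
                         (∀ u → Alternating (map (c u) (orderedNeighbours G σ u))) →
                         ∀ v → Balanced (allVertices G) v
  alternating⇒balanced σ alt v = begin
    count (blueNbrs (allVertices G) v)      ≡⟨ countList-nbrs isBlue ⟨
    countList isBlue colours                ≡⟨ alternating-balanced (alt v) ⟩
    suc (countList (not ∘ isBlue) colours)  ≡⟨ cong suc (countList-nbrs (not ∘ isBlue)) ⟩
    suc (count (redNbrs (allVertices G) v)) ∎
    where
    open ≡-Reasoning
    colours : List Colour
    colours = map (c v) (orderedNeighbours G σ v)
    countList-nbrs : (p : Colour → Bool) → countList p colours ≡ count (λ w → adj v w ∧ p (c v w))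
    countList-nbrs p = begin
      countList p colours
        ≡⟨ countList-map p (c v) (orderedNeighbours G σ v) ⟩
      countList (p ∘ c v) (orderedNeighbours G σ v)
        ≡⟨ countList-filter (p ∘ c v) (adj v) (map (σ ⟨$⟩ʳ_) (allFin n)) ⟩
      countList (λ w → adj v w ∧ p (c v w)) (map (σ ⟨$⟩ʳ_) (allFin n))
        ≡⟨ countList-permutedFin (λ w → adj v w ∧ p (c v w)) σ ⟩
      count (λ w → adj v w ∧ p (c v w)) ∎

  nbr-adj : ∀ (S : VSet G) v w {q} → (S w ∧ adj v w ∧ q) ≡ true → Adj G v w
  nbr-adj S v w nbr = ∧-conicalˡ (adj v w) _ (∧-conicalʳ (S w) _ nbr)

  nbr-colour : ∀ (S : VSet G) v w {q} → (S w ∧ adj v w ∧ q) ≡ true → q ≡ true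
  nbr-colour S v w nbr = ∧-conicalʳ (adj v w) _ (∧-conicalʳ (S w) _ nbr)

  deg-split : ∀ S v → deg G S v ≡ count (blueNbrs S v) + count (redNbrs S v)
  deg-split S v = trans (countᵇ≡count G (λ u → S u ∧ adj v u)) (trans (count-split _ (isBlue ∘ c v))
    (cong₂ _+_ (count-cong (λ w → ∧-assoc (S w) (adj v w) _)) (count-cong (λ w → ∧-assoc (S w) (adj v w) _))))

  without : VSet G → (Fin n → Bool) → VSet G
  without S R w = S w ∧ not (R w)

  nbrs-without : ∀ S R v (P : Fin n → Bool) w →
                 (without S R w ∧ adj v w ∧ P w) ≡ (S w ∧ adj v w ∧ P w) ∧ not (R w)
  nbrs-without S R v P w with S w | R w
  ... | true  | true  = sym (∧-zeroʳ _)
  ... | true  | false = sym (∧-identityʳ _)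
  ... | false | _     = refl

  balanced-without-disjoint : ∀ {S R v} → (∀ w → S w ≡ true → Adj G v w → R w ≡ false) →
                              Balanced S v → Balanced (without S R) v
  balanced-without-disjoint {S} {R} {v} disjoint bal = begin
    count (blueNbrs (without S R) v)               ≡⟨ count-cong blue-without ⟩
    count (λ w → blueNbrs S v w ∧ not (R w))       ≡⟨ count-without-disjoint _ R (λ w → outside w) ⟩
    count (blueNbrs S v)                           ≡⟨ bal ⟩
    suc (count (redNbrs S v))                      ≡⟨ cong suc (count-without-disjoint _ R (λ w → outside w)) ⟨
    suc (count (λ w → redNbrs S v w ∧ not (R w)))  ≡⟨ cong suc (count-cong red-without) ⟨
    suc (count (redNbrs (without S R) v))          ∎
    where
    open ≡-Reasoning
    blue-without = nbrs-without S R v (isBlue ∘ c v)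
    red-without  = nbrs-without S R v (not ∘ isBlue ∘ c v)
    outside : ∀ w {q} → (S w ∧ adj v w ∧ q) ≡ true → R w ≡ false
    outside w nbr = disjoint w (∧-conicalˡ (S w) _ nbr) (nbr-adj S v w nbr)

  balanced-without-pair : ∀ {S R v} a b →
                          blueNbrs S v a ≡ true → R a ≡ true → (∀ w → blueNbrs S v w ≡ true → R w ≡ true → w ≡ a) →
                          redNbrs S v b ≡ true → R b ≡ true → (∀ w → redNbrs S v w ≡ true → R w ≡ true → w ≡ b) →
                          Balanced S v → Balanced (without S R) v
  balanced-without-pair {S} {R} {v} a b blue-a Ra only-a red-b Rb only-b bal = suc-injective (begin
    suc (count (blueNbrs (without S R) v))              ≡⟨ cong suc (count-cong blue-without) ⟩
    suc (count (λ w → blueNbrs S v w ∧ not (R w)))      ≡⟨ count-without-single _ R a blue-a Ra only-a ⟨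
    count (blueNbrs S v)                                ≡⟨ bal ⟩
    suc (count (redNbrs S v))                           ≡⟨ cong suc (count-without-single _ R b red-b Rb only-b) ⟩
    suc (suc (count (λ w → redNbrs S v w ∧ not (R w)))) ≡⟨ cong (λ m → suc (suc m)) (count-cong red-without) ⟨
    suc (suc (count (redNbrs (without S R) v)))         ∎)
    where
    open ≡-Reasoning
    blue-without = nbrs-without S R v (isBlue ∘ c v)
    red-without  = nbrs-without S R v (not ∘ isBlue ∘ c v)

module RootedTree {n : ℕ} (G : Graph n) (tree : IsTree G) (bipartite : Bipartite G) (r : Fin n) where
  open Graph G using (adj) renaming (sym to adj-sym)

  Adj-sym : ∀ {u v} → Adj G u v → Adj G v u
  Adj-sym {u} {v} = trans (adj-sym v u)

  within : ℕ → Fin n → Bool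
  within zero    u = u == r
  within (suc k) u = within k u ∨ does (any? (λ w → adj u w ∧ within k w Bool.≟ true))

  within-step : ∀ k {u w} → Adj G u w → within k w ≡ true → within (suc k) u ≡ true
  within-step k {u} {w} u~w within-w with within k u
  ... | true  = refl
  ... | false = dec-true (any? (λ w → adj u w ∧ within k w Bool.≟ true)) (w , cong₂ _∧_ u~w within-w)

  within-suc⁻ : ∀ k u → within (suc k) u ≡ true →
               within k u ≡ true ⊎ ∃ λ w → Adj G u w × within k w ≡ true
  within-suc⁻ k u within-1+k with within k u
  ... | true  = inj₁ refl
  ... | false with any? (λ w → adj u w ∧ within k w Bool.≟ true)
  ...   | yes (w , step-w) = inj₂ (w , ∧-conicalˡ (adj u w) _ step-w , ∧-conicalʳ (adj u w) _ step-w)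

  walk⇒within : ∀ {u} → Walk G u r → ∃ λ k → within k u ≡ true
  walk⇒within here = zero , ==-refl r
  walk⇒within (step u~w walk) with walk⇒within walk
  ... | k , within-w = suc k , within-step k u~w within-w

  depthSpec : ∀ u → Σ ℕ λ k → within k u ≡ true × (∀ j → j < k → within j u ≡ false)
  depthSpec u with walk⇒within (proj₁ tree u r)
  ... | k , within-k = least-true (λ k → within k u) k within-k

  depth : Fin n → ℕ
  depth u = proj₁ (depthSpec u)

  depth-within : ∀ u → within (depth u) u ≡ true
  depth-within u = proj₁ (proj₂ (depthSpec u))

  depth-below : ∀ {j u} → j < depth u → within j u ≡ false
  depth-below {j} {u} = proj₂ (proj₂ (depthSpec u)) j

  depth-minimal : ∀ k u → within k u ≡ true → depth u ≤ k
  depth-minimal k u within-k with depth u ≤? k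
  ... | yes d≤k = d≤k
  ... | no  d≰k = case trans (sym within-k) (depth-below (≰⇒> d≰k)) of λ ()

  depth-root : depth r ≡ 0
  depth-root = n≤0⇒n≡0 (depth-minimal 0 r (==-refl r))

  depth-suc⇒≢root : ∀ {u k} → depth u ≡ suc k → u ≢ r
  depth-suc⇒≢root du≡1+k refl = case trans (sym du≡1+k) depth-root of λ ()

  depth≡0⇒root : ∀ {u} → depth u ≡ 0 → u ≡ r
  depth≡0⇒root {u} d≡0 = ==⇒≡ (subst (λ k → within k u ≡ true) d≡0 (depth-within u))

  depth-adj : ∀ {u w} → Adj G u w → depth u ≤ suc (depth w)
  depth-adj {u} {w} u~w = depth-minimal (suc (depth w)) u (within-step (depth w) u~w (depth-within w))

  ≢root⇒depth-suc : ∀ {u} → u ≢ r → depth u ≡ suc (pred (depth u))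
  ≢root⇒depth-suc {u} u≢r with depth u in d≡
  ... | zero  = ⊥-elim (u≢r (depth≡0⇒root d≡))
  ... | suc _ = refl

  parentCandidate : Fin n → Fin n → Bool
  parentCandidate u w = adj u w ∧ within (pred (depth u)) w

  -- At the root there is no candidate, and parent r = r.
  parent : Fin n → Fin n
  parent u with any? (λ w → parentCandidate u w Bool.≟ true)
  ... | yes (w , _) = w
  ... | no  _       = u

  parent-spec : ∀ u → u ≢ r → Adj G u (parent u) × depth u ≡ suc (depth (parent u))
  parent-spec u u≢r with any? (λ w → parentCandidate u w Bool.≟ true)
  ... | yes (w , candidate) =
    u~w , ≤-antisym (depth-adj u~w) (subst (suc (depth w) ≤_) (sym d≡1+k) (s≤s dw≤k))
    where
    k = pred (depth u)
    d≡1+k = ≢root⇒depth-suc u≢r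
    u~w = ∧-conicalˡ (adj u w) _ candidate
    dw≤k : depth w ≤ k
    dw≤k = depth-minimal k w (∧-conicalʳ (adj u w) _ candidate)
  ... | no  none = ⊥-elim (none candidate)
    where
    k = pred (depth u)
    d≡1+k = ≢root⇒depth-suc u≢r
    candidate : ∃ λ w → parentCandidate u w ≡ true
    candidate with within-suc⁻ k u (subst (λ d → within d u ≡ true) d≡1+k (depth-within u))
    ... | inj₁ within-k = case trans (sym within-k) (depth-below (subst (k <_) (sym d≡1+k) ≤-refl)) of λ ()
    ... | inj₂ (w , u~w , within-w) = w , cong₂ _∧_ u~w within-w

  parent-adj : ∀ {u} → u ≢ r → Adj G u (parent u)
  parent-adj {u} u≢r = proj₁ (parent-spec u u≢r)

  parent-depth : ∀ {u} → u ≢ r → depth u ≡ suc (depth (parent u))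
  parent-depth {u} u≢r = proj₂ (parent-spec u u≢r)

  side : Fin n → Bool
  side = proj₁ bipartite

  side-depth : ∀ k u → depth u ≡ k → side u ≡ fold (side r) not k
  side-depth zero    u d≡0   = cong side (depth≡0⇒root d≡0)
  side-depth (suc k) u d≡1+k = trans (¬-not (proj₂ bipartite u (parent u) (parent-adj u≢r)))
    (cong not (side-depth k (parent u) (suc-injective (trans (sym (parent-depth u≢r)) d≡1+k))))
    where
    u≢r = depth-suc⇒≢root d≡1+k

  depth-adj-≢ : ∀ {u w} → Adj G u w → depth u ≢ depth w
  depth-adj-≢ {u} {w} u~w du≡dw =
    proj₂ bipartite u w u~w (trans (side-depth _ u du≡dw) (sym (side-depth _ w refl)))

  depth-adj-cases : ∀ {u w} → Adj G u w → depth u ≡ suc (depth w) ⊎ depth w ≡ suc (depth u)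
  depth-adj-cases {u} {w} u~w with <-cmp (depth u) (depth w)
  ... | tri< du<dw _ _ = inj₂ (≤-antisym (depth-adj (Adj-sym u~w)) du<dw)
  ... | tri≈ _ du≡dw _ = ⊥-elim (depth-adj-≢ u~w du≡dw)
  ... | tri> _ _ du>dw = inj₁ (≤-antisym (depth-adj u~w) du>dw)

  ancestor : ℕ → Fin n → Fin n
  ancestor zero    x = x
  ancestor (suc i) x = parent (ancestor i x)

  ≢root-by-depth : ∀ {a i d} → depth a + i ≡ d → i < d → a ≢ r
  ≢root-by-depth {a} {i} da+i≡d i<d a≡r =
    1+n≰n (subst (suc i ≤_) (trans (sym da+i≡d) (cong (_+ i) (trans (cong depth a≡r) depth-root))) i<d)

  depth-ancestor : ∀ i x → i ≤ depth x → depth (ancestor i x) + i ≡ depth x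
  depth-ancestor zero    x _     = +-identityʳ (depth x)
  depth-ancestor (suc i) x i<d = begin
    depth (ancestor (suc i) x) + suc i        ≡⟨ +-suc (depth (ancestor (suc i) x)) i ⟩
    suc (depth (parent (ancestor i x))) + i   ≡⟨ cong (_+ i) (parent-depth (≢root-by-depth ih i<d)) ⟨
    depth (ancestor i x) + i                  ≡⟨ ih ⟩
    depth x                                   ∎
    where
    open ≡-Reasoning
    ih = depth-ancestor i x (<⇒≤ i<d)

  ancestor≢root : ∀ {i x} → i < depth x → ancestor i x ≢ r
  ancestor≢root {i} {x} i<d = ≢root-by-depth (depth-ancestor i x (<⇒≤ i<d)) i<d

  ancestor-adj : ∀ {i x} → i < depth x → Adj G (ancestor i x) (ancestor (suc i) x)
  ancestor-adj i<d = parent-adj (ancestor≢root i<d)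

  ancestor-depth-root : ∀ x → ancestor (depth x) x ≡ r
  ancestor-depth-root x = depth≡0⇒root (+-cancelʳ-≡ (depth x) _ 0 (depth-ancestor (depth x) x ≤-refl))

  ancestor-level : ∀ {i j x y} → i ≤ depth x → j ≤ depth y → depth x ≡ depth y →
                   ancestor i x ≡ ancestor j y → i ≡ j
  ancestor-level {i} {j} {x} {y} i≤dx j≤dy dx≡dy same = +-cancelˡ-≡ (depth (ancestor i x)) i j (begin
    depth (ancestor i x) + i ≡⟨ depth-ancestor i x i≤dx ⟩
    depth x                  ≡⟨ dx≡dy ⟩
    depth y                  ≡⟨ depth-ancestor j y j≤dy ⟨
    depth (ancestor j y) + j ≡⟨ cong (λ a → depth a + j) same ⟨
    depth (ancestor i x) + j ∎)
    where open ≡-Reasoning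

  depth-ancestor-≤ : ∀ {i x} → i ≤ depth x → depth (ancestor i x) ≤ depth x
  depth-ancestor-≤ {i} {x} i≤d = subst (depth (ancestor i x) ≤_) (depth-ancestor i x i≤d) (m≤m+n _ i)

  pathUp : Fin n → ℕ → List (Fin n)
  pathUp x m = applyUpTo (λ i → ancestor i x) (suc m)

  pathDown : Fin n → ℕ → List (Fin n)
  pathDown x m = applyDownFrom (λ i → ancestor i x) m

  pathUp-linked : ∀ {x m} → m ≤ depth x → Linked (Adj G) (pathUp x m)
  pathUp-linked {m = m} m≤d = Linked.applyUpTo⁺₁ _ (suc m) λ 1+i<1+m →
    ancestor-adj (<-≤-trans (≤-pred 1+i<1+m) m≤d)

  pathDown-linked : ∀ {x m} → m ≤ depth x → Linked (Adj G) (pathDown x m)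
  pathDown-linked {m = m} m≤d = Linked.applyDownFrom⁺₁ _ m λ 1+i<m →
    Adj-sym (ancestor-adj (<-≤-trans (<-trans (n<1+n _) 1+i<m) m≤d))

  pathUp-unique : ∀ {x m} → m ≤ depth x → AllPairs _≢_ (pathUp x m)
  pathUp-unique {m = m} m≤d = AllPairs.applyUpTo⁺₁ _ (suc m) λ i<i′ i′<1+m same →
    <⇒≢ i<i′ (ancestor-level (≤-trans (<⇒≤ (<-≤-trans i<i′ (≤-pred i′<1+m))) m≤d)
                             (≤-trans (≤-pred i′<1+m) m≤d) refl same)

  pathDown-unique : ∀ {x m} → m ≤ depth x → AllPairs _≢_ (pathDown x m)
  pathDown-unique {m = m} m≤d = AllPairs.applyDownFrom⁺₁ _ m λ i′<i i<m same →
    <⇒≢ i′<i (sym (ancestor-level (≤-trans (<⇒≤ i<m) m≤d)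
                                  (≤-trans (<⇒≤ (<-trans i′<i i<m)) m≤d) refl same))

  ancestors-cycle : ∀ {u w p k} j → Adj G u w → Adj G u p →
                    depth w ≡ k → depth p ≡ k → depth u ≡ suc k → suc j ≤ k →
                    ancestor (suc j) w ≡ ancestor (suc j) p →
                    (∀ i → i < suc j → ancestor i w ≢ ancestor i p) →
                    IsCycle G u (pathUp w (suc j) ++ pathDown p (suc j))
  ancestors-cycle {u} {w} {p} {k} j u~w u~p refl dp≡k du≡1+k m≤dw meet apart =
    s≤s (s≤s z≤n) ,
    All.++⁺ (All.applyUpTo⁺₁ _ (suc m) (λ i<1+m → above w refl (≤-pred i<1+m)))
            (All.applyDownFrom⁺₁ _ m (λ i<m → above p dp≡k (<⇒≤ i<m)))
      ∷ AllPairs.++⁺ (pathUp-unique m≤dw) (pathDown-unique m≤dp) up-down-distinct ,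
    subst (λ xs → Linked (Adj G) (u ∷ xs)) (sym (++-assoc (pathUp w m) (pathDown p m) (u ∷ [])))
      (u~w ∷ Linked.++⁺ (pathUp-linked m≤dw) up→down (Linked.++⁺ (pathDown-linked m≤dp) down→u [-]))
    where
    m = suc j
    m≤dp = subst (m ≤_) (sym dp≡k) m≤dw
    above : ∀ {i} x → depth x ≡ k → i ≤ m → u ≢ ancestor i x
    above {i} x dx≡k i≤m u≡a = 1+n≰n (begin
      suc k                ≡⟨ du≡1+k ⟨
      depth u              ≡⟨ cong depth u≡a ⟩
      depth (ancestor i x) ≤⟨ depth-ancestor-≤ (subst (i ≤_) (sym dx≡k) (≤-trans i≤m m≤dw)) ⟩
      depth x              ≡⟨ dx≡k ⟩
      k                    ∎)
      where open ≤-Reasoning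
    up-down-distinct : All (λ x → All (x ≢_) (pathDown p m)) (pathUp w m)
    up-down-distinct = All.applyUpTo⁺₁ _ (suc m) λ {i} i<1+m → All.applyDownFrom⁺₁ _ m λ {i′} i′<m same →
      let i≡i′ = ancestor-level (≤-trans (≤-pred i<1+m) m≤dw) (≤-trans (<⇒≤ i′<m) m≤dp) (sym dp≡k) same
      in apart i′ i′<m (subst (λ l → ancestor l w ≡ ancestor i′ p) i≡i′ same)
    up→down : Maybe.Connected (Adj G) (last (pathUp w m)) (just (ancestor j p))
    up→down = subst (λ x → Maybe.Connected (Adj G) x (just (ancestor j p)))
      (sym (last-applyUpTo (λ i → ancestor i w) m))
      (Maybe.just (subst (λ x → Adj G x (ancestor j p)) (sym meet) (Adj-sym (ancestor-adj m≤dp))))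
    down→u : Maybe.Connected (Adj G) (last (pathDown p m)) (just u)
    down→u = subst (λ x → Maybe.Connected (Adj G) x (just u))
      (sym (last-applyDownFrom (λ i → ancestor i p) j)) (Maybe.just (Adj-sym u~p))

  -- Otherwise the paths from w and from p up to their first common ancestor,
  -- joined through u, form a cycle.
  lower-neighbours-equal : ∀ {u w p} → Adj G u w → Adj G u p → depth w ≡ depth p →
                           depth u ≡ suc (depth w) → w ≡ p
  lower-neighbours-equal {u} {w} {p} u~w u~p dw≡dp du≡1+dw =
    first-meeting (least-true meet k meet-at-root)
    where
    k = depth w
    meet : ℕ → Bool
    meet i = ancestor i w == ancestor i p
    meet-at-root : meet k ≡ true
    meet-at-root = dec-true (ancestor k w ≟ ancestor k p)
      (trans (ancestor-depth-root w) (sym (subst (λ l → ancestor l p ≡ r) (sym dw≡dp) (ancestor-depth-root p))))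
    meet≤k : ∀ m → (∀ i → i < m → meet i ≡ false) → m ≤ k
    meet≤k m below with m ≤? k
    ... | yes m≤k = m≤k
    ... | no  m≰k = case trans (sym meet-at-root) (below k (≰⇒> m≰k)) of λ ()
    first-meeting : Σ ℕ (λ m → meet m ≡ true × (∀ i → i < m → meet i ≡ false)) → w ≡ p
    first-meeting (zero  , meet-0 , _)     = ==⇒≡ meet-0
    first-meeting (suc j , meet-m , below) = ⊥-elim (proj₂ tree u _
      (ancestors-cycle j u~w u~p refl (sym dw≡dp) du≡1+dw (meet≤k (suc j) below) (==⇒≡ meet-m) apart))
      where
      apart : ∀ i → i < suc j → ancestor i w ≢ ancestor i p
      apart i i<m same = case trans (sym (below i i<m)) (dec-true (ancestor i w ≟ ancestor i p) same) of λ ()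

  parent-unique : ∀ {u w} → Adj G u w → depth u ≡ suc (depth w) → w ≡ parent u
  parent-unique {u} {w} u~w du≡1+dw = lower-neighbours-equal u~w (parent-adj u≢r)
    (suc-injective (trans (sym du≡1+dw) (parent-depth u≢r))) du≡1+dw
    where
    u≢r = depth-suc⇒≢root du≡1+dw

  neighbour-cases : ∀ {u w} → Adj G u w → (w ≡ parent u × u ≢ r) ⊎ (u ≡ parent w × w ≢ r)
  neighbour-cases {u} {w} u~w with depth-adj-cases u~w
  ... | inj₁ du≡1+dw = inj₁ (parent-unique u~w du≡1+dw , depth-suc⇒≢root du≡1+dw)
  ... | inj₂ dw≡1+du = inj₂ (parent-unique (Adj-sym u~w) dw≡1+du , depth-suc⇒≢root dw≡1+du)

module Pruning {n : ℕ} (T : Graph n) (tree : IsTree T) (bipartite : Bipartite T) (r : Fin n)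
               (c : Fin n → Fin n → Colour) (c-sym : IsEdgeColouring T c) where
  open Graph T using (adj)
  open RootedTree T tree bipartite r
  open ColourBalance T c

  record BalancedSubtree (S : VSet T) : Set where
    field
      root-in   : S r ≡ true
      parent-in : ∀ {u} → S u ≡ true → u ≢ r → S (parent u) ≡ true
      balanced  : ∀ {v} → S v ≡ true → Balanced S v

  child-depth : ∀ {x y} → y ≢ r → parent y ≡ x → depth y ≡ suc (depth x)
  child-depth y≢r refl = parent-depth y≢r

  depth-≢ : ∀ {x y} → depth x < depth y → x ≢ y
  depth-≢ dx<dy refl = <-irrefl refl dx<dy

  module Subtree {S : VSet T} (I : BalancedSubtree S) where
    open BalancedSubtree I

    ChildOf : Fin n → Fin n → Set
    ChildOf x y = S y ≡ true × y ≢ r × parent y ≡ x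

    Childless : Fin n → Set
    Childless x = ∀ y → ¬ ChildOf x y

    childᵇ : Fin n → Fin n → Bool
    childᵇ x w = S w ∧ adj x w ∧ not (w == parent x)

    childᵇ⇒ChildOf : ∀ {x w} → childᵇ x w ≡ true → ChildOf x w
    childᵇ⇒ChildOf {x} {w} ch with neighbour-cases (∧-conicalˡ (adj x w) _ (∧-conicalʳ (S w) _ ch))
    ... | inj₁ (w≡px , _)   = case trans (sym (∧-conicalʳ (adj x w) _ (∧-conicalʳ (S w) _ ch)))
                                         (cong not (dec-true (w ≟ parent x) w≡px)) of λ ()
    ... | inj₂ (x≡pw , w≢r) = ∧-conicalˡ (S w) _ ch , w≢r , sym x≡pw

    child-adj : ∀ {x w} → ChildOf x w → Adj T x w
    child-adj {w = w} (_ , w≢r , pw≡x) = subst (λ y → Adj T y w) pw≡x (Adj-sym (parent-adj w≢r))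

    child-colour : ∀ {x y} → ChildOf x y → c x y ≡ c y (parent y)
    child-colour {x} {y} y-child =
      trans (c-sym x y (child-adj y-child)) (cong (c y) (sym (proj₂ (proj₂ y-child))))

    ChildOf⇒childᵇ : ∀ {x w} → x ≢ r → ChildOf x w → childᵇ x w ≡ true
    ChildOf⇒childᵇ {x} {w} x≢r w-child@(w∈S , w≢r , pw≡x) =
      cong₂ _∧_ w∈S (cong₂ _∧_ (child-adj w-child) (cong not (≢⇒==-false w≢px)))
      where
      w≢px : w ≢ parent x
      w≢px = depth-≢ (begin-strict
        depth (parent x)  <⟨ ≤-refl ⟩
        suc (depth (parent x)) ≡⟨ parent-depth x≢r ⟨
        depth x           <⟨ ≤-refl ⟩
        suc (depth x)     ≡⟨ child-depth w≢r pw≡x ⟨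
        depth w           ∎) ∘ sym
        where open ≤-Reasoning

    nbrs-at-parent : ∀ {x} → S x ≡ true → x ≢ r → (P : Fin n → Bool) →
                     count (λ w → S w ∧ adj x w ∧ P w)
                       ≡ fromBool (P (parent x)) + count (λ w → childᵇ x w ∧ P w)
    nbrs-at-parent {x} x∈S x≢r P = trans (count-pick _ (parent x)) (cong₂ _+_
      (cong fromBool (cong₂ (λ s a → s ∧ a ∧ P (parent x)) (parent-in x∈S x≢r) (parent-adj x≢r)))
      (count-cong (λ w → swap (S w) (adj x w) (P w) (not (w == parent x)))))
      where
      swap : ∀ a b p q → ((a ∧ b ∧ p) ∧ q) ≡ ((a ∧ b ∧ q) ∧ p)
      swap true  true  p q = ∧-comm p q
      swap true  false p q = refl
      swap false b     p q = refl

    childless-leaf : ∀ {x} → S x ≡ true → x ≢ r → Childless x →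
                     deg T S x ≡ 1 × isBlue (c x (parent x)) ≡ true
    childless-leaf {x} x∈S x≢r childless = deg≡1 , b≡true
      where
      b = isBlue (c x (parent x))
      no-children : ∀ P → count (λ w → childᵇ x w ∧ P w) ≡ 0
      no-children P = count-all-false λ w →
        ∧-false (childᵇ x w) (λ ch → ⊥-elim (childless w (childᵇ⇒ChildOf ch)))
      blue-count : count (blueNbrs S x) ≡ fromBool b + 0
      blue-count = trans (nbrs-at-parent x∈S x≢r (isBlue ∘ c x))
                         (cong (fromBool b +_) (no-children (isBlue ∘ c x)))
      red-count : count (redNbrs S x) ≡ fromBool (not b) + 0
      red-count = trans (nbrs-at-parent x∈S x≢r (not ∘ isBlue ∘ c x))
                        (cong (fromBool (not b) +_) (no-children (not ∘ isBlue ∘ c x)))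
      only-blue : ∀ b → fromBool b + 0 ≡ suc (fromBool (not b) + 0) → b ≡ true
      only-blue true _ = refl
      b≡true : b ≡ true
      b≡true = only-blue b (trans (sym blue-count) (trans (balanced x∈S) (cong suc red-count)))
      deg≡1 : deg T S x ≡ 1
      deg≡1 = begin
        deg T S x                                  ≡⟨ deg-split S x ⟩
        count (blueNbrs S x) + count (redNbrs S x) ≡⟨ cong₂ _+_ blue-count red-count ⟩
        (fromBool b + 0) + (fromBool (not b) + 0)  ≡⟨ cong (λ β → (fromBool β + 0) + (fromBool (not β) + 0)) b≡true ⟩
        1                                          ∎
        where open ≡-Reasoning

    record Twig (b : Fin n) : Set where
      field
        leaf₁ leaf₂     : Fin n
        is-twig         : IsTwig T S b leaf₁ leaf₂
        leaf₁-child     : ChildOf b leaf₁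
        leaf₂-child     : ChildOf b leaf₂
        leaf₁-childless : Childless leaf₁
        leaf₂-childless : Childless leaf₂
        only-leaves     : ∀ y → ChildOf b y → y ≡ leaf₁ ⊎ y ≡ leaf₂
        red-to-parent   : isBlue (c b (parent b)) ≡ false

    -- The children are leaves hanging from blue edges, so balance at b forces a red
    -- edge to the parent and exactly two children.
    twig : ∀ {b y₀} → S b ≡ true → b ≢ r → ChildOf b y₀ → (∀ y → ChildOf b y → Childless y) → Twig b
    twig {b} {y₀} b∈S b≢r y₀-child children-childless =
      two-leaves (count≡2 (childᵇ b) (proj₂ parent-red-two-children))
      where
      β = isBlue (c b (parent b))
      children-blue : ∀ w → childᵇ b w ≡ true → isBlue (c b w) ≡ true
      children-blue w ch = trans (cong isBlue (child-colour w-child))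
        (proj₂ (childless-leaf (proj₁ w-child) (proj₁ (proj₂ w-child)) (children-childless w w-child)))
        where w-child = childᵇ⇒ChildOf ch
      blue-count : count (blueNbrs S b) ≡ fromBool β + count (childᵇ b)
      blue-count = trans (nbrs-at-parent b∈S b≢r (isBlue ∘ c b)) (cong (fromBool β +_)
        (count-cong (λ w → ∧-absorbs (childᵇ b w) (children-blue w))))
      red-count : count (redNbrs S b) ≡ fromBool (not β) + 0
      red-count = trans (nbrs-at-parent b∈S b≢r (not ∘ isBlue ∘ c b)) (cong (fromBool (not β) +_)
        (count-all-false (λ w → ∧-false (childᵇ b w) (cong not ∘ children-blue w))))
      red-and-two : ∀ β {k m} → k ≡ suc m → fromBool β + k ≡ suc (fromBool (not β) + 0) → β ≡ false × k ≡ 2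
      red-and-two false _    e  = refl , e
      red-and-two true  refl ()
      parent-red-two-children : β ≡ false × count (childᵇ b) ≡ 2
      parent-red-two-children = red-and-two β (count-pick-true (childᵇ b) y₀ (ChildOf⇒childᵇ b≢r y₀-child))
        (trans (sym blue-count) (trans (balanced b∈S) (cong suc red-count)))
      deg≡3 : deg T S b ≡ 3
      deg≡3 = begin
        deg T S b
          ≡⟨ deg-split S b ⟩
        count (blueNbrs S b) + count (redNbrs S b)
          ≡⟨ cong₂ _+_ blue-count red-count ⟩
        (fromBool β + count (childᵇ b)) + (fromBool (not β) + 0)
          ≡⟨ cong₂ (λ β k → (fromBool β + k) + (fromBool (not β) + 0))
                   (proj₁ parent-red-two-children) (proj₂ parent-red-two-children) ⟩
        3 ∎
        where open ≡-Reasoning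
      leaf : ∀ {l} → ChildOf b l → IsLeaf T S l
      leaf {l} l-child@(l∈S , l≢r , _) = l∈S , proj₁ (childless-leaf l∈S l≢r (children-childless l l-child))
      two-leaves : (∃₂ λ l₁ l₂ → l₁ ≢ l₂ × childᵇ b l₁ ≡ true × childᵇ b l₂ ≡ true ×
                                 (∀ y → childᵇ b y ≡ true → y ≡ l₁ ⊎ y ≡ l₂)) → Twig b
      two-leaves (l₁ , l₂ , l₁≢l₂ , ch-l₁ , ch-l₂ , only-l₁-l₂) = record
        { leaf₁           = l₁
        ; leaf₂           = l₂
        ; is-twig         = b∈S , deg≡3 , l₁≢l₂ , leaf l₁-child , leaf l₂-child
                          , child-adj l₁-child , child-adj l₂-child
        ; leaf₁-child     = l₁-child
        ; leaf₂-child     = l₂-child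
        ; leaf₁-childless = children-childless l₁ l₁-child
        ; leaf₂-childless = children-childless l₂ l₂-child
        ; only-leaves     = λ y y-child → only-l₁-l₂ y (ChildOf⇒childᵇ b≢r y-child)
        ; red-to-parent   = proj₁ parent-red-two-children
        }
        where
        l₁-child = childᵇ⇒ChildOf ch-l₁
        l₂-child = childᵇ⇒ChildOf ch-l₂

    record PrunableAt (g : Fin n) : Set where
      field
        ℓ p         : Fin n
        ℓ-child     : ChildOf g ℓ
        ℓ-childless : Childless ℓ
        ℓ-blue      : isBlue (c g ℓ) ≡ true
        p-child     : ChildOf g p
        p-twig      : Twig p
        p-red       : isBlue (c g p) ≡ false

    depth-bound-childless : ∀ {D x} → (∀ y → S y ≡ true → depth y ≤ D) → depth x ≡ D → Childless x
    depth-bound-childless {D} bound dx≡D y (y∈S , y≢r , py≡x) =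
      1+n≰n (subst (_≤ D) (trans (child-depth y≢r py≡x) (cong suc dx≡D)) (bound y y∈S))

    -- Balance at g gives two blue neighbours, and at most one of them is the parent.
    red-child⇒blue-child : ∀ {g p} → S g ≡ true → ChildOf g p → isBlue (c g p) ≡ false →
                           ∃ λ ℓ → ChildOf g ℓ × isBlue (c g ℓ) ≡ true
    red-child⇒blue-child {g} {p} g∈S p-child p-red =
      ℓ , childᵇ⇒ChildOf (cong₂ _∧_ (∧-conicalˡ (S ℓ) _ blue-ℓ) (cong₂ _∧_ (nbr-adj S g ℓ blue-ℓ) ℓ≢pg))
        , nbr-colour S g ℓ blue-ℓ
      where
      at-least-two : ∀ β {X m} → fromBool β + X ≡ suc (suc m) → ∃ λ k → X ≡ suc k
      at-least-two true  e = _ , suc-injective e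
      at-least-two false e = _ , e
      non-parent-blue = λ w → blueNbrs S g w ∧ not (w == parent g)
      witness : ∃ λ ℓ → non-parent-blue ℓ ≡ true
      witness = count-witness non-parent-blue (proj₂ (at-least-two (blueNbrs S g (parent g)) (begin
        fromBool (blueNbrs S g (parent g)) + count non-parent-blue  ≡⟨ count-pick (blueNbrs S g) (parent g) ⟨
        count (blueNbrs S g)                                        ≡⟨ balanced g∈S ⟩
        suc (count (redNbrs S g))
          ≡⟨ cong suc (count-pick-true (redNbrs S g) p
               (cong₂ _∧_ (proj₁ p-child) (cong₂ _∧_ (child-adj p-child) (cong not p-red)))) ⟩
        suc (suc (count (λ w → redNbrs S g w ∧ not (w == p)))) ∎)))
        where open ≡-Reasoning
      ℓ = proj₁ witness
      blue-ℓ = ∧-conicalˡ (blueNbrs S g ℓ) _ (proj₂ witness)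
      ℓ≢pg = ∧-conicalʳ (blueNbrs S g ℓ) _ (proj₂ witness)

    deepest-prunable : ∀ {u k} → S u ≡ true → depth u ≡ 3 + k → (∀ y → S y ≡ true → depth y ≤ 3 + k) →
                       PrunableAt (parent (parent u))
    deepest-prunable {u} {k} u∈S du≡3+k bound = record
      { ℓ = ℓ ; p = p
      ; ℓ-child = ℓ-child ; ℓ-childless = ℓ-childless ; ℓ-blue = ℓ-blue
      ; p-child = p-child ; p-twig = p-twig ; p-red = p-red
      }
      where
      u≢r = depth-suc⇒≢root du≡3+k
      p = parent u
      p∈S = parent-in u∈S u≢r
      dp≡2+k = suc-injective (trans (sym (parent-depth u≢r)) du≡3+k)
      p≢r = depth-suc⇒≢root dp≡2+k
      g = parent p
      g∈S = parent-in p∈S p≢r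
      p-child : ChildOf g p
      p-child = p∈S , p≢r , refl
      grandchildren-childless : ∀ {x} → ChildOf g x → ∀ y → ChildOf x y → Childless y
      grandchildren-childless {x} (_ , x≢r , px≡g) y (_ , y≢r , py≡x) = depth-bound-childless bound (begin
        depth y                ≡⟨ child-depth y≢r py≡x ⟩
        suc (depth x)          ≡⟨ cong suc (child-depth x≢r px≡g) ⟩
        suc (suc (depth g))    ≡⟨ cong suc (parent-depth p≢r) ⟨
        suc (depth p)          ≡⟨ cong suc dp≡2+k ⟩
        3 + k                  ∎)
        where open ≡-Reasoning
      p-twig : Twig p
      p-twig = twig p∈S p≢r (u∈S , u≢r , refl) (grandchildren-childless p-child)
      p-red : isBlue (c g p) ≡ false
      p-red = trans (cong isBlue (child-colour p-child)) (Twig.red-to-parent p-twig)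
      blue-child = red-child⇒blue-child g∈S p-child p-red
      ℓ = proj₁ blue-child
      ℓ-child = proj₁ (proj₂ blue-child)
      ℓ-blue = proj₂ (proj₂ blue-child)
      ℓ-childless : Childless ℓ
      ℓ-childless y y-child = case trans (sym ℓ-blue) ℓ-red of λ ()
        where
        ℓ-twig = twig (proj₁ ℓ-child) (proj₁ (proj₂ ℓ-child)) y-child (grandchildren-childless ℓ-child)
        ℓ-red : isBlue (c g ℓ) ≡ false
        ℓ-red = trans (cong isBlue (child-colour ℓ-child)) (Twig.red-to-parent ℓ-twig)

    module Prune {g : Fin n} (P : PrunableAt g) where
      open PrunableAt P
      open Twig p-twig renaming (leaf₁ to l₁; leaf₂ to l₂)

      removed : Fin n → Bool
      removed w = (w == ℓ) ∨ (w == p) ∨ (w == l₁) ∨ (w == l₂)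

      S′ : VSet T
      S′ = remove4 T S ℓ p l₁ l₂

      OneOfRemoved : Fin n → Set
      OneOfRemoved w = w ≡ ℓ ⊎ w ≡ p ⊎ w ≡ l₁ ⊎ w ≡ l₂

      removed-cases : ∀ {w} → removed w ≡ true → OneOfRemoved w
      removed-cases {w} rem with w ≟ ℓ | w ≟ p | w ≟ l₁ | w ≟ l₂
      ... | yes w≡ℓ | _       | _        | _        = inj₁ w≡ℓ
      ... | no _    | yes w≡p | _        | _        = inj₂ (inj₁ w≡p)
      ... | no _    | no _    | yes w≡l₁ | _        = inj₂ (inj₂ (inj₁ w≡l₁))
      ... | no _    | no _    | no _     | yes w≡l₂ = inj₂ (inj₂ (inj₂ w≡l₂))

      removed-intro : ∀ {w} → OneOfRemoved w → removed w ≡ true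
      removed-intro {w} w∈ with w ≟ ℓ | w ≟ p | w ≟ l₁ | w ≟ l₂
      ... | yes _ | _     | _     | _     = refl
      ... | no _  | yes _ | _     | _     = refl
      ... | no _  | no _  | yes _ | _     = refl
      ... | no _  | no _  | no _  | yes _ = refl
      ... | no w≢ℓ | no w≢p | no w≢l₁ | no w≢l₂ = ⊥-elim ([ w≢ℓ , [ w≢p , [ w≢l₁ , w≢l₂ ]′ ]′ ]′ w∈)

      ℓ-depth : depth ℓ ≡ suc (depth g)
      ℓ-depth = child-depth (proj₁ (proj₂ ℓ-child)) (proj₂ (proj₂ ℓ-child))

      p-depth : depth p ≡ suc (depth g)
      p-depth = child-depth (proj₁ (proj₂ p-child)) (proj₂ (proj₂ p-child))

      leaf-depth : ∀ {l} → ChildOf p l → depth l ≡ suc (suc (depth g))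
      leaf-depth (_ , l≢r , pl≡p) = trans (child-depth l≢r pl≡p) (cong suc p-depth)

      removed-deeper : ∀ {w} → removed w ≡ true → depth g < depth w
      removed-deeper {w} rem with removed-cases {w} rem
      ... | inj₁ refl               = ≤-reflexive (sym ℓ-depth)
      ... | inj₂ (inj₁ refl)        = ≤-reflexive (sym p-depth)
      ... | inj₂ (inj₂ (inj₁ refl)) = ≤-trans (n≤1+n _) (≤-reflexive (sym (leaf-depth leaf₁-child)))
      ... | inj₂ (inj₂ (inj₂ refl)) = ≤-trans (n≤1+n _) (≤-reflexive (sym (leaf-depth leaf₂-child)))

      g∈S : S g ≡ true
      g∈S = subst (λ z → S z ≡ true) (proj₂ (proj₂ ℓ-child)) (parent-in (proj₁ ℓ-child) (proj₁ (proj₂ ℓ-child)))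

      g≁leaf : ∀ {l} → ChildOf p l → ¬ Adj T g l
      g≁leaf l-child g~l with depth-adj-cases g~l
      ... | inj₁ dg≡1+dl = m≢1+n+m (depth g) (trans dg≡1+dl (cong suc (leaf-depth l-child)))
      ... | inj₂ dl≡1+dg = 1+n≢n (suc-injective (trans (sym (leaf-depth l-child)) dl≡1+dg))

      colour-≢ : ∀ {x y} → isBlue (c g x) ≡ true → isBlue (c g y) ≡ false → x ≢ y
      colour-≢ x-blue y-red x≡y = case trans (sym x-blue) (trans (cong (isBlue ∘ c g) x≡y) y-red) of λ ()

      config : LeafTwigConfig T S g ℓ p l₁ l₂
      config = g∈S , (proj₁ ℓ-child , proj₁ (childless-leaf (proj₁ ℓ-child) (proj₁ (proj₂ ℓ-child)) ℓ-childless))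
             , is-twig , child-adj ℓ-child , child-adj p-child
             , deeper-≢g ℓ-depth , deeper-≢g p-depth
             , deeper-≢g (leaf-depth leaf₁-child) , deeper-≢g (leaf-depth leaf₂-child)
             , colour-≢ ℓ-blue p-red , ℓ≢leaf leaf₁-child , ℓ≢leaf leaf₂-child
        where
        deeper-≢g : ∀ {w k} → depth w ≡ suc (k + depth g) → w ≢ g
        deeper-≢g {w} {k} dw≡ = depth-≢ (≤-trans (s≤s (m≤n+m (depth g) k)) (≤-reflexive (sym dw≡))) ∘ sym
        ℓ≢leaf : ∀ {l} → ChildOf p l → ℓ ≢ l
        ℓ≢leaf l-child = depth-≢ (≤-reflexive (trans (cong suc ℓ-depth) (sym (leaf-depth l-child))))

      removed-nbr : ∀ {x w} → S x ≡ true → Adj T x w → removed w ≡ true → removed x ≡ true ⊎ x ≡ g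
      removed-nbr {x} {w} x∈S x~w rem with neighbour-cases x~w
      ... | inj₁ (w≡px , x≢r) = child-case (removed-cases {w} rem)
        where
        x-child : ∀ {y} → w ≡ y → ChildOf y x
        x-child w≡y = x∈S , x≢r , trans (sym w≡px) w≡y
        child-case : OneOfRemoved w → removed x ≡ true ⊎ x ≡ g
        child-case (inj₁ w≡ℓ)                = ⊥-elim (ℓ-childless x (x-child w≡ℓ))
        child-case (inj₂ (inj₁ w≡p))         = inj₁ (removed-intro (inj₂ (inj₂ (only-leaves x (x-child w≡p)))))
        child-case (inj₂ (inj₂ (inj₁ w≡l₁))) = ⊥-elim (leaf₁-childless x (x-child w≡l₁))
        child-case (inj₂ (inj₂ (inj₂ w≡l₂))) = ⊥-elim (leaf₂-childless x (x-child w≡l₂))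
      ... | inj₂ (x≡pw , _) = parent-case (removed-cases {w} rem)
        where
        parent-of : ∀ {y z} → w ≡ y → parent y ≡ z → x ≡ z
        parent-of w≡y py≡z = trans x≡pw (trans (cong parent w≡y) py≡z)
        parent-case : OneOfRemoved w → removed x ≡ true ⊎ x ≡ g
        parent-case (inj₁ w≡ℓ)                = inj₂ (parent-of w≡ℓ (proj₂ (proj₂ ℓ-child)))
        parent-case (inj₂ (inj₁ w≡p))         = inj₂ (parent-of w≡p (proj₂ (proj₂ p-child)))
        parent-case (inj₂ (inj₂ (inj₁ w≡l₁))) =
          inj₁ (removed-intro (inj₂ (inj₁ (parent-of w≡l₁ (proj₂ (proj₂ leaf₁-child))))))
        parent-case (inj₂ (inj₂ (inj₂ w≡l₂))) =
          inj₁ (removed-intro (inj₂ (inj₁ (parent-of w≡l₂ (proj₂ (proj₂ leaf₂-child))))))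

      kept : ∀ {w} → S′ w ≡ true → S w ≡ true × removed w ≡ false
      kept {w} w∈S′ = ∧-conicalˡ (S w) _ w∈S′ , not-injective (∧-conicalʳ (S w) _ w∈S′)

      kept-not-removed : ∀ {w} → S′ w ≡ true → removed w ≢ true
      kept-not-removed w∈S′ w-rem = case trans (sym w-rem) (proj₂ (kept w∈S′)) of λ ()

      keep : ∀ {w} → S w ≡ true → removed w ≢ true → S′ w ≡ true
      keep w∈S not-removed = cong₂ _∧_ w∈S (cong not (¬-not not-removed))

      blue-removed-nbr : ∀ w → blueNbrs S g w ≡ true → removed w ≡ true → w ≡ ℓ
      blue-removed-nbr w blue-w rem with removed-cases {w} rem
      ... | inj₁ w≡ℓ                = w≡ℓ
      ... | inj₂ (inj₁ w≡p)         = ⊥-elim (colour-≢ (nbr-colour S g w blue-w) p-red w≡p)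
      ... | inj₂ (inj₂ (inj₁ w≡l₁)) = ⊥-elim (g≁leaf leaf₁-child (subst (Adj T g) w≡l₁ (nbr-adj S g w blue-w)))
      ... | inj₂ (inj₂ (inj₂ w≡l₂)) = ⊥-elim (g≁leaf leaf₂-child (subst (Adj T g) w≡l₂ (nbr-adj S g w blue-w)))

      red-removed-nbr : ∀ w → redNbrs S g w ≡ true → removed w ≡ true → w ≡ p
      red-removed-nbr w red-w rem with removed-cases {w} rem
      ... | inj₁ w≡ℓ                = ⊥-elim (colour-≢ ℓ-blue (not-injective (nbr-colour S g w red-w)) (sym w≡ℓ))
      ... | inj₂ (inj₁ w≡p)         = w≡p
      ... | inj₂ (inj₂ (inj₁ w≡l₁)) = ⊥-elim (g≁leaf leaf₁-child (subst (Adj T g) w≡l₁ (nbr-adj S g w red-w)))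
      ... | inj₂ (inj₂ (inj₂ w≡l₂)) = ⊥-elim (g≁leaf leaf₂-child (subst (Adj T g) w≡l₂ (nbr-adj S g w red-w)))

      -- Only g has neighbours among the removed vertices, and it loses one blue (ℓ)
      -- and one red (p) neighbour.
      invariant : BalancedSubtree S′
      invariant = record { root-in = root-in′ ; parent-in = parent-in′ ; balanced = balanced′ }
        where
        root-in′ : S′ r ≡ true
        root-in′ = keep root-in (λ rem → n≮0 (subst (depth g <_) depth-root (removed-deeper {r} rem)))
        parent-in′ : ∀ {v} → S′ v ≡ true → v ≢ r → S′ (parent v) ≡ true
        parent-in′ {v} v∈S′ v≢r = keep (parent-in v∈S v≢r) parent-kept
          where
          v∈S = proj₁ (kept v∈S′)
          parent-kept : removed (parent v) ≢ true
          parent-kept rem with removed-nbr v∈S (parent-adj v≢r) rem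
          ... | inj₁ v-rem = kept-not-removed v∈S′ v-rem
          ... | inj₂ v≡g   = <-irrefl refl (<-trans (removed-deeper {parent v} rem) (subst (λ z → depth (parent v) < depth z)
                                                                                        v≡g (≤-reflexive (sym (parent-depth v≢r)))))
        balanced′ : ∀ {v} → S′ v ≡ true → Balanced S′ v
        balanced′ {v} v∈S′ with v ≟ g
        ... | yes refl = balanced-without-pair {S} {removed} ℓ p
          ℓ-nbr (removed-intro (inj₁ refl)) blue-removed-nbr
          p-nbr (removed-intro (inj₂ (inj₁ refl))) red-removed-nbr
          (balanced g∈S)
          where
          ℓ-nbr : blueNbrs S g ℓ ≡ true
          ℓ-nbr = cong₂ _∧_ (proj₁ ℓ-child) (cong₂ _∧_ (child-adj ℓ-child) ℓ-blue)
          p-nbr : redNbrs S g p ≡ true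
          p-nbr = cong₂ _∧_ (proj₁ p-child) (cong₂ _∧_ (child-adj p-child) (cong not p-red))
        ... | no v≢g = balanced-without-disjoint {S} {removed} far (balanced (proj₁ (kept v∈S′)))
          where
          far : ∀ w → S w ≡ true → Adj T v w → removed w ≡ false
          far w _ v~w = ¬-not λ rem → [ kept-not-removed v∈S′ , v≢g ]′ (removed-nbr (proj₁ (kept v∈S′)) v~w rem)

      shrinks : count S′ < count S
      shrinks = subst (count S′ <_) (sym (count-split S removed)) (m<n+m (count S′) some-removed)
        where
        some-removed : 0 < count (λ w → S w ∧ removed w)
        some-removed = subst (0 <_)
          (sym (count-pick-true _ ℓ (cong₂ _∧_ (proj₁ ℓ-child) (removed-intro (inj₁ refl))))) z<s

      removal-step : RemovalStep T S S′
      removal-step = removal g ℓ p l₁ l₂ config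

    module Shallow (shallow : ∀ y → S y ≡ true → depth y ≤ 2) where

      root-child-twig : ∀ {b y} → S b ≡ true → ChildOf r b → ChildOf b y → Twig b
      root-child-twig b∈S (_ , b≢r , pb≡r) y-child = twig b∈S b≢r y-child λ y′ (_ , y′≢r , py′≡b) →
        depth-bound-childless shallow
          (trans (child-depth y′≢r py′≡b) (cong suc (trans (child-depth b≢r pb≡r) (cong suc depth-root))))

      twig-base : ∀ {b} → Twig b → TwigBaseAt T S r b
      twig-base tw = leaf₁ , leaf₂ , is-twig , proj₁ (proj₂ leaf₁-child) , proj₁ (proj₂ leaf₂-child)
        where open Twig tw

      classify : ∀ {u} → S u ≡ true → Adj T r u →
                 (IsLeaf T S u × isBlue (c r u) ≡ true)
                 ⊎ (TwigBaseAt T S r u × deg T S u ≡ 3 × isBlue (c r u) ≡ false)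
      classify {u} u∈S r~u with neighbour-cases r~u
      ... | inj₁ (_ , r≢r) = ⊥-elim (r≢r refl)
      ... | inj₂ (r≡pu , u≢r) with any? (λ y → childᵇ u y Bool.≟ true)
      ...   | yes (y , ch) =
        inj₂ (twig-base tw , proj₁ (proj₂ (Twig.is-twig tw)) , trans root-colour (Twig.red-to-parent tw))
        where
        tw = root-child-twig u∈S (u∈S , u≢r , sym r≡pu) (childᵇ⇒ChildOf ch)
        root-colour = cong isBlue (child-colour (u∈S , u≢r , sym r≡pu))
      ...   | no  none = inj₁ ((u∈S , proj₁ leaf) , trans root-colour (proj₂ leaf))
        where
        leaf = childless-leaf u∈S u≢r λ y y-child → none (y , ChildOf⇒childᵇ u≢r y-child)
        root-colour = cong isBlue (child-colour (u∈S , u≢r , sym r≡pu))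

      star : StarOfLeavesAndTwigs T S r
      star = root-in , (λ u u∈S r~u → Sum.map proj₁ proj₁ (classify u∈S r~u)) , near-root
        where
        near-root : ∀ u → S u ≡ true → u ≢ r →
                    Adj T r u ⊎ ∃ λ b → S b ≡ true × Adj T r b × TwigBaseAt T S r b × Adj T b u
        near-root u u∈S u≢r with parent u ≟ r
        ... | yes pu≡r = inj₁ (child-adj (u∈S , u≢r , pu≡r))
        ... | no  b≢r  =
          inj₂ (b , b∈S , child-adj b-child , twig-base (root-child-twig b∈S b-child u-child) , child-adj u-child)
          where
          b = parent u
          b∈S = parent-in u∈S u≢r
          u-child : ChildOf b u
          u-child = u∈S , u≢r , refl
          pb≡r : parent b ≡ r
          pb≡r = depth≡0⇒root (n≤0⇒n≡0 (≤-pred (≤-pred (subst (_≤ 2) two-steps (shallow u u∈S)))))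
            where
            two-steps : depth u ≡ suc (suc (depth (parent b)))
            two-steps = trans (parent-depth u≢r) (cong suc (parent-depth b≢r))
          b-child : ChildOf r b
          b-child = b∈S , b≢r , pb≡r

      degree-colour : ∀ {u} → S u ≡ true → Adj T r u →
                      does (deg T S u ℕ.≟ 1) ≡ isBlue (c r u) × does (deg T S u ℕ.≟ 3) ≡ not (isBlue (c r u))
      degree-colour u∈S r~u with classify u∈S r~u
      ... | inj₁ ((_ , deg≡1) , is-blue) rewrite deg≡1 | is-blue = refl , refl
      ... | inj₂ (_ , deg≡3 , is-red)    rewrite deg≡3 | is-red  = refl , refl

      nbrs-cong : ∀ {x y : Fin n → Bool} → (∀ {u} → S u ≡ true → Adj T r u → x u ≡ y u) →
                  ∀ u → (S u ∧ adj r u ∧ x u) ≡ (S u ∧ adj r u ∧ y u)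
      nbrs-cong x≗y u with S u in u∈S | adj r u in r~u
      ... | true  | true  = x≗y u∈S r~u
      ... | true  | false = refl
      ... | false | _     = refl

      one-more-leaf : numLeavesAt T S r ≡ suc (numTwigsAt T S r)
      one-more-leaf = begin
        numLeavesAt T S r               ≡⟨ countᵇ≡count T leaf-test ⟩
        count leaf-test                 ≡⟨ count-cong (nbrs-cong (proj₁ ∘₂ degree-colour)) ⟩
        count (blueNbrs S r)            ≡⟨ balanced root-in ⟩
        suc (count (redNbrs S r))       ≡⟨ cong suc (count-cong (nbrs-cong (proj₂ ∘₂ degree-colour))) ⟨
        suc (count twig-test)           ≡⟨ cong suc (countᵇ≡count T twig-test) ⟨
        suc (numTwigsAt T S r)          ∎
        where
        open ≡-Reasoning
        leaf-test twig-test : Fin n → Bool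
        leaf-test u = S u ∧ adj r u ∧ does (deg T S u ℕ.≟ 1)
        twig-test u = S u ∧ adj r u ∧ does (deg T S u ℕ.≟ 3)

  Reduction : VSet T → Set
  Reduction S = Σ (VSet T) λ S′ → Removals T S S′ × StarOfLeavesAndTwigs T S′ r
                                 × numLeavesAt T S′ r ≡ suc (numTwigsAt T S′ r)

  reduce : ∀ S → BalancedSubtree S → Acc _<_ (count S) → Reduction S
  reduce S I (acc smaller) with argmax S depth
  ... | inj₁ empty = case trans (sym (BalancedSubtree.root-in I)) (empty r) of λ ()
  ... | inj₂ (u , u∈S , bound) with depth u ≤? 2
  ...   | yes du≤2 = S , ε , star , one-more-leaf
    where
    open Subtree I
    shallow : ∀ y → S y ≡ true → depth y ≤ 2
    shallow y y∈S = ≤-trans (bound y y∈S) du≤2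
    open Shallow shallow
  ...   | no  du≰2 = prune (deepest-prunable u∈S du≡3+k (λ y y∈S → subst (depth y ≤_) du≡3+k (bound y y∈S)))
    where
    open Subtree I
    du≡3+k : depth u ≡ 3 + (depth u ∸ 3)
    du≡3+k = sym (m+[n∸m]≡n (≰⇒> du≰2))
    prune : ∀ {g} → PrunableAt g → Reduction S
    prune P = map₂ (map₁ (removal-step ◅_)) (reduce S′ invariant (smaller shrinks))
      where open Prune P

mainTheorem5 : (n : ℕ) (T : Graph n) → IsTree T → ASBGColourable T → (r : Fin n) →
               Σ (VSet T) λ S → Removals T (allVertices T) S
                 × StarOfLeavesAndTwigs T S r
                 × numLeavesAt T S r ≡ suc (numTwigsAt T S r)
mainTheorem5 n T tree (c , (bipartite , _ , c-sym , σ , alternating)) r =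
  reduce (allVertices T) whole (<-wellFounded (count (allVertices T)))
  where
  open Pruning T tree bipartite r c c-sym
  whole : BalancedSubtree (allVertices T)
  whole = record
    { root-in   = refl
    ; parent-in = λ _ _ → refl
    ; balanced  = λ {v} _ → ColourBalance.alternating⇒balanced T c σ alternating v
    }
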